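{- Let $n$ be sufficiently large, let the word size $w\ge 7\log_2 n$ be an even perfect cube, let $B=w^{1/3}$, and let $l=B^{j}w$ for some integer $j\ge0$ with $Bl\le n$. Assume $B\log_2(l+1)\le w/2$, and let $n2^{w/2}\le\sigma\le 2^w/n$. Suppose each $k_1,\dots,k_B\in[2^w+\sigma]$ is the spillover of a data structure with space $[2^w+\sigma]\times\{0,1\}^{l-w}$ for arrays in $\{0,1\}^l$ that supports rank queries on the array (so distinct arrays have distinct representations) and whose number of ones is a function $\mathrm{SUM}(k)\in\{0,\dots,l\}$ of the spillover $k$ alone; let $T_i=\sum_{j\le i}\mathrm{SUM}(k_j)$. Then, in the cell-probe model with word size $w$, one can construct a data structure for $(k_1,\dots,k_B)$ using space $[K]\times\{0,1\}^m$ with $m=(B-1)w$ and $K\le 2^w+2B\sigma$, such that each $k_i$ and each $T_i$ ($1\le i\le B$) can be decoded in constant time.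
   Context: $[K]$ denotes $\{0,1,\dots,K-1\}$. A data structure with space $[K]\times\{0,1\}^m$ is represented by a pair consisting of a spillover $k\in[K]$ and a string of $m$ bits; at query time the spillover is given for free and any $w$ consecutive bits of the $m$-bit string can be read in constant time. Cell-probe model: only memory accesses are counted; arbitrary computation is free. -}

module Defs where

open import Data.Nat using (ℕ; zero; suc; _+_; _*_; _∸_; _≤_)
open import Data.Bool using (Bool; true; false)
open import Data.Fin using (Fin; zero; suc; toℕ)
open import Data.Vec using (Vec; []; _∷_; tabulate)
open import Data.Product using (_×_; proj₁; proj₂)
open import Relation.Binary.PropositionalEquality using (_≡_)
open import Function using (_∘_)

-- Reading bit position p of an m-bit memory; positions ≥ m read as false
-- (padding convention; gives no extra power to a query algorithm).
bitAt : {m : ℕ} → Vec Bool m → ℕ → Bool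
bitAt []       _       = false
bitAt (b ∷ bs) zero    = b
bitAt (b ∷ bs) (suc p) = bitAt bs p

readWord : {m : ℕ} → (w : ℕ) → Vec Bool m → ℕ → Vec Bool w
readWord w mem p = tabulate (λ j → bitAt mem (p + toℕ j))

-- Cell-probe query algorithm (word size w): an adaptive decision tree whose
-- nodes read the w consecutive bits starting at a chosen position and whose
-- leaves return an answer. Computation is free (arbitrary branching).
data Prog (w : ℕ) (A : Set) : Set where
  ret  : A → Prog w A
  read : ℕ → (Vec Bool w → Prog w A) → Prog w A

run : {w m : ℕ} {A : Set} → Prog w A → Vec Bool m → A
run (ret a)    mem = a
run {w} (read p k) mem = run (k (readWord w mem p)) mem

probes : {w m : ℕ} {A : Set} → Prog w A → Vec Bool m → ℕ
probes (ret a)    mem = 0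
probes {w} (read p k) mem = suc (probes (k (readWord w mem p)) mem)

ones : {l : ℕ} → Vec Bool l → ℕ
ones []           = 0
ones (true ∷ bs)  = suc (ones bs)
ones (false ∷ bs) = ones bs

prefixSum : {B : ℕ} → (Fin B → ℕ) → Fin B → ℕ
prefixSum f zero    = f zero
prefixSum f (suc i) = f zero + prefixSum (f ∘ suc) i

record TupleDS (w S B K m c : ℕ) (SUM : Fin S → ℕ) : Set where
  field
    encode : (Fin B → Fin S) → Fin K × Vec Bool m
    decK   : Fin B → Fin K → Prog w (Fin S)
    decT   : Fin B → Fin K → Prog w ℕ
    decK-correct : ∀ ks i →
      run (decK i (proj₁ (encode ks))) (proj₂ (encode ks)) ≡ ks i
    decT-correct : ∀ ks i →
      run (decT i (proj₁ (encode ks))) (proj₂ (encode ks))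
        ≡ prefixSum (λ j → SUM (ks j)) i
    decK-time : ∀ ks i → probes (decK i (proj₁ (encode ks))) (proj₂ (encode ks)) ≤ c
    decT-time : ∀ ks i → probes (decT i (proj₁ (encode ks))) (proj₂ (encode ks)) ≤ c

-- Keys are grouped by their label SUM k and identified by their rank within
-- their label class.  A class of size N < 2^(w+1) is cut along the binary
-- expansion of N into blocks of sizes 2^e, so a key becomes a type (label, e),
-- one of P = (l+1)(w+1) values, together with an e-bit offset in its block.
-- For a tuple, the types fix where each offset sits in the concatenation Y of
-- the B offsets.  The low (B-2)w bits of Y are stored verbatim; the type tuple
-- and the high part of Y are numbered jointly by a slot, enumerating type
-- tuples lexicographically with ⌈∏ 2^(e_i) / 2^((B-2)w)⌉ slots each.  The
-- next w stored bits are the low bits of the slot and the rest of the slot is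
-- the spillover.  As the block sizes of all types add up to 2^w + σ, there are
-- at most (2^w + σ)^B / 2^((B-2)w) + P^B slots, which the estimate
-- (1 + x)^B ≤ 1 + 3Bx/2 for 3Bx ≤ 1 and P^B ≤ σ 2^w bring below
-- (2^w + 2Bσ) 2^w.  A query reads the slot word, which determines the types
-- (hence all prefix sums of labels and all offset positions) and the high part
-- of Y; a second read fetches the wanted offset.

module Submission where

open import Defs
open import Data.Nat
open import Data.Nat.Properties
open import Data.Nat.DivMod
open import Data.Nat.Divisibility using (divides-refl; n∣m*n; m∣m*n)
open import Data.Nat.Tactic.RingSolver using (solve-∀)
open import Algebra.Properties.CommutativeSemigroup +-commutativeSemigroup using (interchange)
open import Algebra.Properties.CommutativeSemigroup *-commutativeSemigroup using () renaming (interchange to *-interchange)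
open import Data.Bool using (Bool; if_then_else_)
import Data.Bool.Properties as Bool
open import Data.Fin using (Fin; toℕ; fromℕ<)
import Data.Fin as Fin
open import Data.Fin.Properties using (toℕ<n; toℕ-fromℕ<; fromℕ<-toℕ; toℕ-injective; any?)
open import Data.Vec using (Vec; []; _∷_; lookup; map; tabulate)
open import Data.Vec.Properties using (lookup∘tabulate; lookup-map; ≡-dec)
open import Data.Vec.Relation.Unary.All using (All; []; _∷_)
open import Data.Product using (Σ; _×_; _,_; proj₁; proj₂)
open import Data.Unit using (tt)
open import Data.Empty using (⊥-elim)
open import Function.Definitions using (Injective)
open import Relation.Binary.PropositionalEquality
open import Relation.Binary.Definitions using (tri<; tri≈; tri>)
open import Relation.Nullary using (Dec; yes; no)
open import Relation.Nullary.Decidable using (⌊_⌋; _×-dec_; toWitness)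

-- Finite sums and ranks within classes

sumBelow : ℕ → (ℕ → ℕ) → ℕ
sumBelow zero    f = 0
sumBelow (suc n) f = sumBelow n f + f n

sumBelow-cong : ∀ n {f g : ℕ → ℕ} → (∀ i → i < n → f i ≡ g i) → sumBelow n f ≡ sumBelow n g
sumBelow-cong zero    f≡g = refl
sumBelow-cong (suc n) f≡g = cong₂ _+_ (sumBelow-cong n λ i i<n → f≡g i (m<n⇒m<1+n i<n)) (f≡g n ≤-refl)

sumBelow-mono : ∀ n {f g : ℕ → ℕ} → (∀ i → i < n → f i ≤ g i) → sumBelow n f ≤ sumBelow n g
sumBelow-mono zero    f≤g = ≤-refl
sumBelow-mono (suc n) f≤g = +-mono-≤ (sumBelow-mono n λ i i<n → f≤g i (m<n⇒m<1+n i<n)) (f≤g n ≤-refl)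

sumBelow-distrib-+ : ∀ n (f g : ℕ → ℕ) → sumBelow n (λ i → f i + g i) ≡ sumBelow n f + sumBelow n g
sumBelow-distrib-+ zero    f g = refl
sumBelow-distrib-+ (suc n) f g = trans (cong (_+ (f n + g n)) (sumBelow-distrib-+ n f g))
                                      (interchange (sumBelow n f) (sumBelow n g) (f n) (g n))

sumBelow-distribˡ-* : ∀ n c (f : ℕ → ℕ) → sumBelow n (λ i → c * f i) ≡ c * sumBelow n f
sumBelow-distribˡ-* zero    c f = sym (*-zeroʳ c)
sumBelow-distribˡ-* (suc n) c f = trans (cong (_+ c * f n) (sumBelow-distribˡ-* n c f))
                                       (sym (*-distribˡ-+ c (sumBelow n f) (f n)))

sumBelow-const : ∀ n c → sumBelow n (λ _ → c) ≡ n * c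
sumBelow-const zero    c = refl
sumBelow-const (suc n) c = trans (cong (_+ c) (sumBelow-const n c)) (+-comm (n * c) c)

sumBelow-+ : ∀ m n (f : ℕ → ℕ) → sumBelow (m + n) f ≡ sumBelow m f + sumBelow n (λ i → f (m + i))
sumBelow-+ m zero    f = trans (cong (λ k → sumBelow k f) (+-identityʳ m)) (sym (+-identityʳ _))
sumBelow-+ m (suc n) f = begin
  sumBelow (m + suc n) f                                  ≡⟨ cong (λ k → sumBelow k f) (+-suc m n) ⟩
  sumBelow (m + n) f + f (m + n)                          ≡⟨ cong (_+ f (m + n)) (sumBelow-+ m n f) ⟩
  sumBelow m f + sumBelow n (λ i → f (m + i)) + f (m + n) ≡⟨ +-assoc (sumBelow m f) _ _ ⟩
  sumBelow m f + sumBelow (suc n) (λ i → f (m + i))       ∎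
  where open ≡-Reasoning

sumBelow-* : ∀ a c (f : ℕ → ℕ) → sumBelow (a * c) f ≡ sumBelow a (λ s → sumBelow c (λ e → f (s * c + e)))
sumBelow-* zero    c f = refl
sumBelow-* (suc a) c f = begin
  sumBelow (c + a * c) f                                    ≡⟨ cong (λ k → sumBelow k f) (+-comm c (a * c)) ⟩
  sumBelow (a * c + c) f                                    ≡⟨ sumBelow-+ (a * c) c f ⟩
  sumBelow (a * c) f + sumBelow c (λ e → f (a * c + e))     ≡⟨ cong (_+ sumBelow c (λ e → f (a * c + e))) (sumBelow-* a c f) ⟩
  sumBelow (suc a) (λ s → sumBelow c (λ e → f (s * c + e))) ∎
  where open ≡-Reasoning

sumBelow-comm : ∀ a c (f : ℕ → ℕ → ℕ) →
                sumBelow a (λ i → sumBelow c (f i)) ≡ sumBelow c (λ j → sumBelow a (λ i → f i j))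
sumBelow-comm zero    c f = sym (trans (sumBelow-const c 0) (*-zeroʳ c))
sumBelow-comm (suc a) c f = trans (cong (_+ sumBelow c (f a)) (sumBelow-comm a c f))
                                 (sym (sumBelow-distrib-+ c (λ j → sumBelow a (λ i → f i j)) (f a)))

sumBelow-monoˡ-≤ : ∀ {m n} (f : ℕ → ℕ) → m ≤ n → sumBelow m f ≤ sumBelow n f
sumBelow-monoˡ-≤ {m} f m≤n with m≤n⇒∃[o]m+o≡n m≤n
... | o , refl = subst (sumBelow m f ≤_) (sym (sumBelow-+ m o f)) (m≤m+n _ _)

δ : ℕ → ℕ → ℕ
δ x s = if ⌊ x ≟ s ⌋ then 1 else 0

δ-refl : ∀ x → δ x x ≡ 1
δ-refl x with x ≟ x
... | yes _   = refl
... | no x≢x = ⊥-elim (x≢x refl)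

δ-≢ : ∀ {x s} → x ≢ s → δ x s ≡ 0
δ-≢ {x} {s} x≢s with x ≟ s
... | yes x≡s = ⊥-elim (x≢s x≡s)
... | no _    = refl

δ≤1 : ∀ x s → δ x s ≤ 1
δ≤1 x s with x ≟ s
... | yes _ = ≤-refl
... | no _  = z≤n

sumBelow-δ-below : ∀ {x} L → L ≤ x → sumBelow L (δ x) ≡ 0
sumBelow-δ-below zero    _       = refl
sumBelow-δ-below (suc L) 1+L≤x = cong₂ _+_ (sumBelow-δ-below L (<⇒≤ 1+L≤x)) (δ-≢ (>⇒≢ 1+L≤x))

sumBelow-δ : ∀ {x} L → x < L → sumBelow L (δ x) ≡ 1
sumBelow-δ {x} (suc L) x<1+L with x ≟ L
... | yes refl = cong (_+ 1) (sumBelow-δ-below x ≤-refl)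
... | no x≢L   = cong (_+ 0) (sumBelow-δ L (≤∧≢⇒< (≤-pred x<1+L) x≢L))

count : (ℕ → ℕ) → ℕ → ℕ → ℕ
count c s n = sumBelow n (λ j → δ (c j) s)

count≤ : ∀ c s n → count c s n ≤ n
count≤ c s n = ≤-trans (sumBelow-mono n λ j _ → δ≤1 (c j) s) (≤-reflexive (trans (sumBelow-const n 1) (*-identityʳ n)))

sumBelow-count : ∀ c L n → (∀ j → c j < L) → sumBelow L (λ s → count c s n) ≡ n
sumBelow-count c L n c<L = begin
  sumBelow L (λ s → count c s n)          ≡⟨ sumBelow-comm L n (λ s j → δ (c j) s) ⟩
  sumBelow n (λ j → sumBelow L (δ (c j))) ≡⟨ sumBelow-cong n (λ j _ → sumBelow-δ L (c<L j)) ⟩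
  sumBelow n (λ _ → 1)                    ≡⟨ trans (sumBelow-const n 1) (*-identityʳ n) ⟩
  n                                       ∎
  where open ≡-Reasoning

rank : (ℕ → ℕ) → ℕ → ℕ
rank c x = count c (c x) x

rank<count : ∀ c {x n} → x < n → rank c x < count c (c x) n
rank<count c {x} {n} x<n = subst (_≤ count c (c x) n)
  (trans (cong (rank c x +_) (δ-refl (c x))) (+-comm (rank c x) 1)) (sumBelow-monoˡ-≤ _ x<n)

rank-injective : ∀ c {x y} → c x ≡ c y → rank c x ≡ rank c y → x ≡ y
rank-injective c {x} {y} cx≡cy rx≡ry with <-cmp x y
... | tri< x<y _ _ = ⊥-elim (<-irrefl rx≡ry (subst (λ s → rank c x < count c s y) cx≡cy (rank<count c x<y)))
... | tri≈ _ x≡y _ = x≡y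
... | tri> _ _ y<x = ⊥-elim (<-irrefl (sym rx≡ry) (subst (λ s → rank c y < count c s x) (sym cx≡cy) (rank<count c y<x)))

-- Binary expansions

2^-nonZero : ∀ e → NonZero (2 ^ e)
2^-nonZero e = m^n≢0 2 e

infixl 7 _/2^_ _%2^_

_/2^_ : ℕ → ℕ → ℕ
x /2^ j = _/_ x (2 ^ j) {{2^-nonZero j}}

_%2^_ : ℕ → ℕ → ℕ
x %2^ j = _%_ x (2 ^ j) {{2^-nonZero j}}

bit : ℕ → ℕ → ℕ
bit j x = x /2^ j % 2

%2^-suc : ∀ x t → x %2^ suc t ≡ x %2^ t + bit t x * 2 ^ t
%2^-suc x t = begin
  x %2^ suc t                                   ≡⟨ m≡m%n+[m/n]*n (x %2^ suc t) (2 ^ t) ⟩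
  x %2^ suc t %2^ t + x %2^ suc t /2^ t * 2 ^ t ≡⟨ cong₂ (λ a b → a + b * 2 ^ t)
                                                      (m∣n⇒o%n%m≡o%m (2 ^ t) (2 ^ suc t) x (n∣m*n 2))
                                                      (m%[n*o]/o≡m/o%n x 2 (2 ^ t)) ⟩
  x %2^ t + bit t x * 2 ^ t                     ∎
  where
  open ≡-Reasoning
  instance
    _ = 2^-nonZero t
    _ = 2^-nonZero (suc t)

bit<2 : ∀ j x → bit j x < 2
bit<2 j x = m%n<n (x /2^ j) 2

[m+kn]/n≡m/n+k : ∀ m k n .{{_ : NonZero n}} → (m + k * n) / n ≡ m / n + k
[m+kn]/n≡m/n+k m k n = trans (+-distrib-/-∣ʳ m (divides-refl k)) (cong (m / n +_) (m*n/n≡m k n))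

/2^-/2^ : ∀ x p j → x /2^ p /2^ j ≡ x /2^ (p + j)
/2^-/2^ x p j = trans (m/n/o≡m/[n*o] x (2 ^ p) (2 ^ j)) (/-congʳ (sym (^-distribˡ-+-* 2 p j)))
  where
  instance
    _ = 2^-nonZero p
    _ = 2^-nonZero j
    _ = 2^-nonZero (p + j)
    _ = m*n≢0 (2 ^ p) (2 ^ j)

bit-/2^ : ∀ p j x → bit j (x /2^ p) ≡ bit (p + j) x
bit-/2^ p j x = cong (_% 2) (/2^-/2^ x p j)

bit-%2^ : ∀ {j q} x → j < q → bit j (x %2^ q) ≡ bit j x
bit-%2^ {j} {q} x j<q with m≤n⇒∃[o]m+o≡n j<q
... | d , refl = begin
  x % 2 ^ (suc j + d) / 2 ^ j % 2     ≡⟨ cong (λ y → y / 2 ^ j % 2) (%-congʳ 2^q≡2^d*2^j) ⟩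
  x % (2 ^ suc d * 2 ^ j) / 2 ^ j % 2 ≡⟨ cong (_% 2) (m%[n*o]/o≡m/o%n x (2 ^ suc d) (2 ^ j)) ⟩
  x / 2 ^ j % 2 ^ suc d % 2           ≡⟨ m∣n⇒o%n%m≡o%m 2 (2 ^ suc d) (x / 2 ^ j) (m∣m*n (2 ^ d)) ⟩
  x / 2 ^ j % 2                       ∎
  where
  open ≡-Reasoning
  2^q≡2^d*2^j : 2 ^ (suc j + d) ≡ 2 ^ suc d * 2 ^ j
  2^q≡2^d*2^j = trans (cong (2 ^_) (trans (sym (+-suc j d)) (+-comm j (suc d)))) (^-distribˡ-+-* 2 (suc d) j)
  instance
    _ = 2^-nonZero j
    _ = 2^-nonZero (suc d)
    _ = 2^-nonZero (suc j + d)
    _ = m*n≢0 (2 ^ suc d) (2 ^ j)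

bit-low : ∀ {j q} L t → j < q → bit j (L + t * 2 ^ q) ≡ bit j L
bit-low {j} {q} L t j<q = begin
  bit j (L + t * 2 ^ q)         ≡⟨ bit-%2^ (L + t * 2 ^ q) j<q ⟨
  bit j ((L + t * 2 ^ q) %2^ q) ≡⟨ cong (bit j) ([m+kn]%n≡m%n L t (2 ^ q)) ⟩
  bit j (L %2^ q)               ≡⟨ bit-%2^ L j<q ⟩
  bit j L                       ∎
  where
  open ≡-Reasoning
  instance _ = 2^-nonZero q

bit-high : ∀ q d {L} t → L < 2 ^ q → bit (q + d) (L + t * 2 ^ q) ≡ bit d t
bit-high q d {L} t L<2^q = begin
  bit (q + d) (L + t * 2 ^ q)   ≡⟨ bit-/2^ q d (L + t * 2 ^ q) ⟨
  bit d ((L + t * 2 ^ q) /2^ q) ≡⟨ cong (bit d) ([m+kn]/n≡m/n+k L t (2 ^ q)) ⟩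
  bit d (L /2^ q + t)           ≡⟨ cong (λ y → bit d (y + t)) (m<n⇒m/n≡0 L<2^q) ⟩
  bit d t                       ∎
  where
  open ≡-Reasoning
  instance _ = 2^-nonZero q

bits-agree⇒%2^≡ : ∀ e {x y} → (∀ j → j < e → bit j x ≡ bit j y) → x %2^ e ≡ y %2^ e
bits-agree⇒%2^≡ zero    {x} {y} _     = trans (n%1≡0 x) (sym (n%1≡0 y))
bits-agree⇒%2^≡ (suc e) {x} {y} agree = begin
  x %2^ suc e               ≡⟨ %2^-suc x e ⟩
  x %2^ e + bit e x * 2 ^ e ≡⟨ cong₂ (λ a b → a + b * 2 ^ e)
                               (bits-agree⇒%2^≡ e (λ j j<e → agree j (m<n⇒m<1+n j<e))) (agree e ≤-refl) ⟩
  y %2^ e + bit e y * 2 ^ e ≡⟨ %2^-suc y e ⟨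
  y %2^ suc e               ∎
  where open ≡-Reasoning

bitField : ℕ → ℕ → ℕ → ℕ
bitField p e x = x /2^ p %2^ e

bits-agree⇒bitField≡ : ∀ p e {x y} → (∀ j → j < e → bit (p + j) x ≡ bit (p + j) y) →
                       bitField p e x ≡ bitField p e y
bits-agree⇒bitField≡ p e {x} {y} agree = bits-agree⇒%2^≡ e λ j j<e →
  trans (bit-/2^ p j x) (trans (agree j j<e) (sym (bit-/2^ p j y)))

⌈_/2^_⌉ : ℕ → ℕ → ℕ
⌈ x /2^ q ⌉ = (x + (2 ^ q ∸ 1)) /2^ q

/2^<⌈/2^⌉ : ∀ q {x y} → x < y → x /2^ q < ⌈ y /2^ q ⌉
/2^<⌈/2^⌉ q {x} {y} x<y = subst (_≤ ⌈ y /2^ q ⌉) (m*n/n≡m (suc (x /2^ q)) (2 ^ q)) (/-monoˡ-≤ (2 ^ q) (begin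
  suc (x /2^ q) * 2 ^ q   ≡⟨ +-comm (2 ^ q) (x /2^ q * 2 ^ q) ⟩
  x /2^ q * 2 ^ q + 2 ^ q ≤⟨ +-monoˡ-≤ (2 ^ q) (m/n*n≤m x (2 ^ q)) ⟩
  x + 2 ^ q               ≡⟨ cong (x +_) (suc-pred (2 ^ q)) ⟨
  x + suc (2 ^ q ∸ 1)     ≡⟨ +-suc x (2 ^ q ∸ 1) ⟩
  suc x + (2 ^ q ∸ 1)     ≤⟨ +-monoˡ-≤ (2 ^ q ∸ 1) x<y ⟩
  y + (2 ^ q ∸ 1)         ∎))
  where
  open ≤-Reasoning
  instance _ = 2^-nonZero q

⌈/2^⌉*2^≤ : ∀ q x → ⌈ x /2^ q ⌉ * 2 ^ q ≤ x + 2 ^ q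
⌈/2^⌉*2^≤ q x = ≤-trans (m/n*n≤m (x + (2 ^ q ∸ 1)) (2 ^ q)) (+-monoʳ-≤ x (m∸n≤m (2 ^ q) 1))
  where instance _ = 2^-nonZero q

[kn+m]/n≡k : ∀ k {m n} .{{_ : NonZero n}} → m < n → (k * n + m) / n ≡ k
[kn+m]/n≡k k {m} {n} m<n = trans (cong (_/ n) (+-comm (k * n) m))
                             (trans ([m+kn]/n≡m/n+k m k n) (cong (_+ k) (m<n⇒m/n≡0 m<n)))

[kn+m]%n≡m : ∀ k {m n} .{{_ : NonZero n}} → m < n → (k * n + m) % n ≡ m
[kn+m]%n≡m k {m} {n} m<n = trans (cong (_% n) (+-comm (k * n) m)) (trans ([m+kn]%n≡m%n m k n) (m<n⇒m%n≡m m<n))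

sumBelow-bits : ∀ t x → sumBelow t (λ e → bit e x * 2 ^ e) ≡ x %2^ t
sumBelow-bits zero    x = sym (n%1≡0 x)
sumBelow-bits (suc t) x = trans (cong (_+ bit t x * 2 ^ t) (sumBelow-bits t x)) (sym (%2^-suc x t))

-- Binary block decomposition

blockIndex : ℕ → ℕ → ℕ → ℕ
blockIndex N zero    x = zero
blockIndex N (suc t) x with N %2^ suc t ≤? x
... | yes _ = suc t
... | no _  = blockIndex N t x

blockIndex-bounds : ∀ N t x → x < N %2^ suc t →
  let e = blockIndex N t x in e ≤ t × N %2^ e ≤ x × x < N %2^ suc e
blockIndex-bounds N zero    x x<N = z≤n , subst (_≤ x) (sym (n%1≡0 N)) z≤n , x<N
blockIndex-bounds N (suc t) x x<N with N %2^ suc t ≤? x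
... | yes N≤x = ≤-refl , N≤x , x<N
... | no N≰x  = let e≤t , below , above = blockIndex-bounds N t x (≰⇒> N≰x) in m≤n⇒m≤1+n e≤t , below , above

blockOffset : ℕ → ℕ → ℕ → ℕ
blockOffset N t x = x ∸ N %2^ blockIndex N t x

blockIndex+blockOffset : ∀ N t x → x < N %2^ suc t → N %2^ blockIndex N t x + blockOffset N t x ≡ x
blockIndex+blockOffset N t x x<N = m+[n∸m]≡n (proj₁ (proj₂ (blockIndex-bounds N t x x<N)))

blockOffset<blockSize : ∀ N t x → x < N %2^ suc t →
  let e = blockIndex N t x in blockOffset N t x < bit e N * 2 ^ e
blockOffset<blockSize N t x x<N = +-cancelˡ-< (N %2^ e) _ _ (begin-strict
  N %2^ e + blockOffset N t x ≡⟨ blockIndex+blockOffset N t x x<N ⟩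
  x                           <⟨ proj₂ (proj₂ (blockIndex-bounds N t x x<N)) ⟩
  N %2^ suc e                 ≡⟨ %2^-suc N e ⟩
  N %2^ e + bit e N * 2 ^ e   ∎)
  where
  open ≤-Reasoning
  e : ℕ
  e = blockIndex N t x

bit-blockIndex : ∀ N t x → x < N %2^ suc t → bit (blockIndex N t x) N ≡ 1
bit-blockIndex N t x x<N = bit≡1 (bit<2 (blockIndex N t x) N) (blockOffset<blockSize N t x x<N)
  where
  bit≡1 : ∀ {b k o} → b < 2 → k < b * o → b ≡ 1
  bit≡1 {zero}        _                 ()
  bit≡1 {suc zero}    _                 _ = refl
  bit≡1 {suc (suc b)} (s≤s (s≤s ())) _

blockOffset<2^ : ∀ N t x → x < N %2^ suc t → blockOffset N t x < 2 ^ blockIndex N t x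
blockOffset<2^ N t x x<N = subst (λ b → blockOffset N t x < b)
  (trans (cong (_* 2 ^ blockIndex N t x) (bit-blockIndex N t x x<N)) (*-identityˡ _))
  (blockOffset<blockSize N t x x<N)

-- Numbers stored as bit strings

toBits : ∀ m → ℕ → Vec Bool m
toBits zero    x = []
toBits (suc m) x = (x % 2 ≡ᵇ 1) ∷ toBits m (x / 2)

bitAt-toBits : ∀ m j x → j < m → bitAt (toBits m x) j ≡ (bit j x ≡ᵇ 1)
bitAt-toBits (suc m) zero    x _         = cong (λ y → y % 2 ≡ᵇ 1) (sym (n/1≡n x))
bitAt-toBits (suc m) (suc j) x (s≤s j<m) = trans (bitAt-toBits m j (x / 2) j<m) (cong (_≡ᵇ 1) (bit-/2^ 1 j x))

≡ᵇ1-injective : ∀ {a b} → a < 2 → b < 2 → (a ≡ᵇ 1) ≡ (b ≡ᵇ 1) → a ≡ b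
≡ᵇ1-injective {0}     {0}     _              _              _  = refl
≡ᵇ1-injective {1}     {1}     _              _              _  = refl
≡ᵇ1-injective {0}     {1}     _              _              ()
≡ᵇ1-injective {1}     {0}     _              _              ()
≡ᵇ1-injective {suc (suc a)} (s≤s (s≤s ())) _ _
≡ᵇ1-injective {b = suc (suc b)} _ (s≤s (s≤s ())) _

readWord-≡⇒bitAt-≡ : ∀ w {m} (M M′ : Vec Bool m) p → readWord w M p ≡ readWord w M′ p →
                     ∀ j → j < w → bitAt M (p + j) ≡ bitAt M′ (p + j)
readWord-≡⇒bitAt-≡ w M M′ p same j j<w =
  subst (λ i → bitAt M (p + i) ≡ bitAt M′ (p + i)) (toℕ-fromℕ< j<w) (begin
    bitAt M (p + _)                       ≡⟨ lookup∘tabulate _ (fromℕ< j<w) ⟨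
    lookup (readWord w M p) (fromℕ< j<w)  ≡⟨ cong (λ W → lookup W (fromℕ< j<w)) same ⟩
    lookup (readWord w M′ p) (fromℕ< j<w) ≡⟨ lookup∘tabulate _ (fromℕ< j<w) ⟩
    bitAt M′ (p + _)                      ∎)
  where open ≡-Reasoning

readWord-toBits-≡⇒bit-≡ : ∀ w m {x y} p → readWord w (toBits m x) p ≡ readWord w (toBits m y) p →
                          ∀ j → j < w → p + j < m → bit (p + j) x ≡ bit (p + j) y
readWord-toBits-≡⇒bit-≡ w m {x} {y} p same j j<w p+j<m = ≡ᵇ1-injective (bit<2 (p + j) x) (bit<2 (p + j) y)
  (trans (sym (bitAt-toBits m (p + j) x p+j<m))
    (trans (readWord-≡⇒bitAt-≡ w (toBits m x) (toBits m y) p same j j<w) (bitAt-toBits m (p + j) y p+j<m)))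

-- Lexicographic enumeration of tuples

module Tuples (P : ℕ) where

  sumTuples : ∀ n → (Vec ℕ n → ℕ) → ℕ
  sumTuples zero    F = F []
  sumTuples (suc n) F = sumBelow P (λ b → sumTuples n (λ g → F (b ∷ g)))

  blockStart : ∀ n → (Vec ℕ n → ℕ) → Vec ℕ n → ℕ
  blockStart zero    F []      = 0
  blockStart (suc n) F (b ∷ g) = sumBelow b (λ b′ → sumTuples n (λ g′ → F (b′ ∷ g′))) + blockStart n (λ g′ → F (b ∷ g′)) g

  blockStart+<sumTuples : ∀ n F {g h} → All (_< P) g → h < F g → blockStart n F g + h < sumTuples n F
  blockStart+<sumTuples zero    F {[]}    []         h<F = h<F
  blockStart+<sumTuples (suc n) F {b ∷ g} {h} (b<P ∷ g<P) h<F = begin-strict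
    sumBelow b G + blockStart n (λ g′ → F (b ∷ g′)) g + h   ≡⟨ +-assoc (sumBelow b G) _ h ⟩
    sumBelow b G + (blockStart n (λ g′ → F (b ∷ g′)) g + h) <⟨ +-monoʳ-< (sumBelow b G) (blockStart+<sumTuples n _ g<P h<F) ⟩
    sumBelow (suc b) G                                      ≤⟨ sumBelow-monoˡ-≤ G b<P ⟩
    sumBelow P G                                            ∎
    where
    open ≤-Reasoning
    G : ℕ → ℕ
    G b′ = sumTuples n (λ g′ → F (b′ ∷ g′))

  private
    blockStart-<-head : ∀ n F {b b′ g g′ h h′} → b < b′ → All (_< P) g → h < F (b ∷ g) →
      blockStart (suc n) F (b ∷ g) + h < blockStart (suc n) F (b′ ∷ g′) + h′
    blockStart-<-head n F {b} {b′} {g} {g′} {h} {h′} b<b′ g<P h<F = begin-strict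
      sumBelow b G + blockStart n (λ g″ → F (b ∷ g″)) g + h   ≡⟨ +-assoc (sumBelow b G) _ h ⟩
      sumBelow b G + (blockStart n (λ g″ → F (b ∷ g″)) g + h) <⟨ +-monoʳ-< (sumBelow b G) (blockStart+<sumTuples n _ g<P h<F) ⟩
      sumBelow (suc b) G                                      ≤⟨ sumBelow-monoˡ-≤ G b<b′ ⟩
      sumBelow b′ G                                           ≤⟨ m≤m+n _ _ ⟩
      sumBelow b′ G + blockStart n (λ g″ → F (b′ ∷ g″)) g′    ≤⟨ m≤m+n _ _ ⟩
      blockStart (suc n) F (b′ ∷ g′) + h′                     ∎
      where
      open ≤-Reasoning
      G : ℕ → ℕ
      G b″ = sumTuples n (λ g″ → F (b″ ∷ g″))

  blockStart-injective : ∀ n F {g g′ h h′} → All (_< P) g → All (_< P) g′ → h < F g → h′ < F g′ →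
    blockStart n F g + h ≡ blockStart n F g′ + h′ → g ≡ g′ × h ≡ h′
  blockStart-injective zero    F {[]}    {[]}      _          _            _   _    eq = refl , eq
  blockStart-injective (suc n) F {b ∷ g} {b′ ∷ g′} {h} {h′} (_ ∷ g<P) (_ ∷ g′<P) h<F h′<F eq with <-cmp b b′
  ... | tri< b<b′ _ _ = ⊥-elim (<-irrefl eq (blockStart-<-head n F b<b′ g<P h<F))
  ... | tri> _ _ b′<b = ⊥-elim (<-irrefl (sym eq) (blockStart-<-head n F b′<b g′<P h′<F))
  ... | tri≈ _ refl _ = cong (b ∷_) (proj₁ tails≡) , proj₂ tails≡
    where
    F′ : Vec ℕ n → ℕ
    F′ g″ = F (b ∷ g″)
    S : ℕ
    S = sumBelow b (λ b″ → sumTuples n (λ g″ → F (b″ ∷ g″)))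
    tails≡ : g ≡ g′ × h ≡ h′
    tails≡ = blockStart-injective n F′ g<P g′<P h<F h′<F (+-cancelˡ-≡ S _ _
      (trans (sym (+-assoc S (blockStart n F′ g) h)) (trans eq (+-assoc S (blockStart n F′ g′) h′))))

  sumTuples-mono : ∀ n {F G : Vec ℕ n → ℕ} → (∀ g → F g ≤ G g) → sumTuples n F ≤ sumTuples n G
  sumTuples-mono zero    F≤G = F≤G []
  sumTuples-mono (suc n) F≤G = sumBelow-mono P (λ b _ → sumTuples-mono n (λ g → F≤G (b ∷ g)))

  sumTuples-distrib-+ : ∀ n (F G : Vec ℕ n → ℕ) → sumTuples n (λ g → F g + G g) ≡ sumTuples n F + sumTuples n G
  sumTuples-distrib-+ zero    F G = refl
  sumTuples-distrib-+ (suc n) F G =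
    trans (sumBelow-cong P (λ b _ → sumTuples-distrib-+ n (λ g → F (b ∷ g)) (λ g → G (b ∷ g))))
          (sumBelow-distrib-+ P _ _)

  sumTuples-distribˡ-* : ∀ n c (F : Vec ℕ n → ℕ) → sumTuples n (λ g → c * F g) ≡ c * sumTuples n F
  sumTuples-distribˡ-* zero    c F = refl
  sumTuples-distribˡ-* (suc n) c F =
    trans (sumBelow-cong P (λ b _ → sumTuples-distribˡ-* n c (λ g → F (b ∷ g)))) (sumBelow-distribˡ-* P c _)

  sumTuples-const : ∀ n c → sumTuples n (λ _ → c) ≡ P ^ n * c
  sumTuples-const zero    c = sym (+-identityʳ c)
  sumTuples-const (suc n) c = trans (sumBelow-cong P (λ _ _ → sumTuples-const n c))
                                    (trans (sumBelow-const P (P ^ n * c)) (sym (*-assoc P (P ^ n) c)))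

  product : ∀ {n} → (ℕ → ℕ) → Vec ℕ n → ℕ
  product f []      = 1
  product f (b ∷ g) = f b * product f g

  sumTuples-product : ∀ n (f : ℕ → ℕ) → sumTuples n (product f) ≡ sumBelow P f ^ n
  sumTuples-product zero    f = refl
  sumTuples-product (suc n) f = begin
    sumBelow P (λ b → sumTuples n (λ g → f b * product f g)) ≡⟨ sumBelow-cong P (λ b _ → sumTuples-distribˡ-* n (f b) (product f)) ⟩
    sumBelow P (λ b → f b * sumTuples n (product f))         ≡⟨ sumBelow-cong P (λ b _ → *-comm (f b) _) ⟩
    sumBelow P (λ b → sumTuples n (product f) * f b)         ≡⟨ sumBelow-distribˡ-* P (sumTuples n (product f)) f ⟩
    sumTuples n (product f) * sumBelow P f                   ≡⟨ cong (_* sumBelow P f) (sumTuples-product n f) ⟩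
    sumBelow P f ^ n * sumBelow P f                          ≡⟨ *-comm (sumBelow P f ^ n) _ ⟩
    sumBelow P f ^ suc n                                     ∎
    where open ≡-Reasoning

-- Decoding by exhaustive search

Searchable : Set → Set₁
Searchable X = ∀ {P : X → Set} → (∀ x → Dec (P x)) → Dec (Σ X P)

Fin-searchable : ∀ {n} → Searchable (Fin n)
Fin-searchable P? = any? P?

Vec-searchable : ∀ {A} → Searchable A → ∀ n → Searchable (Vec A n)
Vec-searchable search zero P? with P? []
... | yes p  = yes ([] , p)
... | no ¬p  = no λ { ([] , p) → ¬p p }
Vec-searchable search (suc n) P? with search (λ a → Vec-searchable search n (λ v → P? (a ∷ v)))
... | yes (a , v , p) = yes (a ∷ v , p)
... | no ¬p           = no λ { (a ∷ v , p) → ¬p (a , v , p) }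

module DecodingBySearch {w K m : ℕ} {X : Set} (search : Searchable X) (encode : X → Fin K × Vec Bool m) where

  spill : X → Fin K
  spill x = proj₁ (encode x)

  memory : X → Vec Bool m
  memory x = proj₂ (encode x)

  Agree : ℕ → X → X → Set
  Agree p x y = spill x ≡ spill y × readWord w (memory x) p ≡ readWord w (memory y) p

  private
    Seen : Fin K → ℕ → Vec Bool w → X → Set
    Seen k p W x = spill x ≡ k × readWord w (memory x) p ≡ W

    seen? : ∀ k p W x → Dec (Seen k p W x)
    seen? k p W x = (spill x Fin.≟ k) ×-dec ≡-dec Bool._≟_ (readWord w (memory x) p) W

    seen-Agree : ∀ {p x y} → Seen (spill x) p (readWord w (memory x) p) y → Agree p x y
    seen-Agree (k≡ , W≡) = sym k≡ , sym W≡

  TwoProbeDecoder : {A : Set} → (X → A) → Set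
  TwoProbeDecoder {A} f = Σ (Fin K → Prog w A) λ decode →
    ∀ x → run (decode (spill x)) (memory x) ≡ f x × probes (decode (spill x)) (memory x) ≡ 2

  -- Computation is free, so after each probe the decoder searches for any input consistent
  -- with the words read so far; the hypotheses make every such input give the right answer.
  decodeBySearch : ∀ {A : Set} → A → (p₀ : ℕ) (p₁ : X → ℕ) (f : X → A) →
    (∀ {x y} → Agree p₀ x y → p₁ x ≡ p₁ y) →
    (∀ {x y} → Agree p₀ x y → Agree (p₁ x) x y → f x ≡ f y) →
    TwoProbeDecoder f
  decodeBySearch {A} default p₀ p₁ f p₁-determined f-determined = decoder , λ x → decoder-correct x , refl
    where
    Seen₂ : Fin K → Vec Bool w → ℕ → Vec Bool w → X → Set
    Seen₂ k W₀ p W₁ x = Seen k p₀ W₀ x × Seen k p W₁ x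

    answer : ∀ {P : X → Set} → Dec (Σ X P) → A
    answer (yes (y , _)) = f y
    answer (no _)        = default

    secondProbe : ∀ {P : X → Set} → Dec (Σ X P) → ℕ
    secondProbe (yes (y , _)) = p₁ y
    secondProbe (no _)        = p₀

    position : Fin K → Vec Bool w → ℕ
    position k W₀ = secondProbe (search (seen? k p₀ W₀))

    decoder : Fin K → Prog w A
    decoder k = read p₀ λ W₀ → read (position k W₀) λ W₁ →
                ret (answer (search (λ x → seen? k p₀ W₀ x ×-dec seen? k (position k W₀) W₁ x)))

    position-correct : ∀ x (d : Dec (Σ X (Seen (spill x) p₀ (readWord w (memory x) p₀)))) → secondProbe d ≡ p₁ x
    position-correct x (yes (y , seen)) = sym (p₁-determined (seen-Agree seen))
    position-correct x (no ¬seen)       = ⊥-elim (¬seen (x , refl , refl))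

    answer-correct : ∀ x {p} → p ≡ p₁ x →
      (d : Dec (Σ X (Seen₂ (spill x) (readWord w (memory x) p₀) p (readWord w (memory x) p)))) → answer d ≡ f x
    answer-correct x refl (yes (y , seen₀ , seen₁)) = sym (f-determined (seen-Agree seen₀) (seen-Agree seen₁))
    answer-correct x _    (no ¬seen)                = ⊥-elim (¬seen (x , (refl , refl) , (refl , refl)))

    decoder-correct : ∀ x → run (decoder (spill x)) (memory x) ≡ f x
    decoder-correct x = answer-correct x (position-correct x (search (seen? k p₀ W₀)))
                          (search (λ y → seen? k p₀ W₀ y ×-dec seen? k (position k W₀) (readWord w (memory x) (position k W₀)) y))
      where
      k : Fin K
      k = spill x
      W₀ : Vec Bool w
      W₀ = readWord w (memory x) p₀

-- The encoding of a tuple of keys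

-- (1 + x)^k ≤ 1 + 3kx/2 for x = σ/M with 3kx ≤ 1, cleared of denominators.
binomial-bound : ∀ M σ k → 3 * k * σ ≤ M → 2 * M * (M + σ) ^ k ≤ 2 * M ^ suc k + 3 * k * σ * M ^ k
binomial-bound M σ zero    _   = ≤-reflexive (unit M)
  where
  unit : ∀ M → 2 * M * 1 ≡ 2 * (M * 1) + 0
  unit = solve-∀
binomial-bound M σ (suc k) 3kσ≤M = begin
  2 * M * ((M + σ) * (M + σ) ^ k)                 ≡⟨ commute M σ ((M + σ) ^ k) ⟩
  (M + σ) * (2 * M * (M + σ) ^ k)                 ≤⟨ *-monoʳ-≤ (M + σ) (binomial-bound M σ k 3kσ≤M′) ⟩
  (M + σ) * (2 * M ^ suc k + 3 * k * σ * M ^ k)   ≡⟨ expand M σ (M ^ k) k ⟩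
  2 * M ^ suc (suc k) + 3 * k * σ * M ^ suc k + 2 * σ * M ^ suc k + 3 * k * σ * (σ * M ^ k)
                                                  ≤⟨ +-monoʳ-≤ _ (*-monoˡ-≤ (σ * M ^ k) 3kσ≤M′) ⟩
  2 * M ^ suc (suc k) + 3 * k * σ * M ^ suc k + 2 * σ * M ^ suc k + M * (σ * M ^ k)
                                                  ≡⟨ collect M σ (M ^ k) k ⟩
  2 * M ^ suc (suc k) + 3 * suc k * σ * M ^ suc k ∎
  where
  open ≤-Reasoning
  3kσ≤M′ : 3 * k * σ ≤ M
  3kσ≤M′ = ≤-trans (*-monoˡ-≤ σ (*-monoʳ-≤ 3 (n≤1+n k))) 3kσ≤M
  commute : ∀ M σ Z → 2 * M * ((M + σ) * Z) ≡ (M + σ) * (2 * M * Z)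
  commute = solve-∀
  expand : ∀ M σ Z k → (M + σ) * (2 * (M * Z) + 3 * k * σ * Z) ≡
                       2 * (M * (M * Z)) + 3 * k * σ * (M * Z) + 2 * σ * (M * Z) + 3 * k * σ * (σ * Z)
  expand = solve-∀
  collect : ∀ M σ Z k → 2 * (M * (M * Z)) + 3 * k * σ * (M * Z) + 2 * σ * (M * Z) + M * (σ * Z) ≡
                       2 * (M * (M * Z)) + 3 * suc k * σ * (M * Z)
  collect = solve-∀

prefixSum-cong : ∀ {n} {f g : Fin n → ℕ} → (∀ j → f j ≡ g j) → ∀ i → prefixSum f i ≡ prefixSum g i
prefixSum-cong f≡g Fin.zero    = f≡g Fin.zero
prefixSum-cong f≡g (Fin.suc i) = cong₂ _+_ (f≡g Fin.zero) (prefixSum-cong (λ j → f≡g (Fin.suc j)) i)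

module TupleCode (w σ l b : ℕ) (SUM : Fin (2 ^ w + σ) → Fin (l + 1)) (σ<2^w : σ < 2 ^ w) where

  S : ℕ
  S = 2 ^ w + σ

  B : ℕ
  B = suc (suc b)

  S<2^1+w : S < 2 ^ suc w
  S<2^1+w = +-monoʳ-< (2 ^ w) (subst (σ <_) (sym (+-identityʳ (2 ^ w))) σ<2^w)

  label : Fin S → ℕ
  label k = toℕ (SUM k)

  -- Positions outside [S] get the junk label 0; only positions below S are ever counted.
  labelℕ : ℕ → ℕ
  labelℕ j with j <? S
  ... | yes j<S = label (fromℕ< j<S)
  ... | no _    = 0

  labelℕ<1+l : ∀ j → labelℕ j < l + 1
  labelℕ<1+l j with j <? S
  ... | yes j<S = toℕ<n (SUM (fromℕ< j<S))
  ... | no _    = subst (0 <_) (+-comm 1 l) (s≤s z≤n)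

  labelℕ-toℕ : ∀ k → labelℕ (toℕ k) ≡ label k
  labelℕ-toℕ k with toℕ k <? S
  ... | yes k<S = cong label (fromℕ<-toℕ k k<S)
  ... | no k≮S  = ⊥-elim (k≮S (toℕ<n k))

  classSize : ℕ → ℕ
  classSize s = count labelℕ s S

  classSize<2^1+w : ∀ s → classSize s < 2 ^ suc w
  classSize<2^1+w s = ≤-<-trans (count≤ labelℕ s S) S<2^1+w

  class : Fin S → ℕ
  class k = labelℕ (toℕ k)

  keyRank : Fin S → ℕ
  keyRank k = rank labelℕ (toℕ k)

  keyRank<classSize : ∀ k → keyRank k < classSize (class k) %2^ suc w
  keyRank<classSize k = subst (keyRank k <_) (sym (m<n⇒m%n≡m (classSize<2^1+w (class k))))
                          (rank<count labelℕ (toℕ<n k))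
    where instance _ = 2^-nonZero (suc w)

  exponent : Fin S → ℕ
  exponent k = blockIndex (classSize (class k)) w (keyRank k)

  offset : Fin S → ℕ
  offset k = blockOffset (classSize (class k)) w (keyRank k)

  exponent≤w : ∀ k → exponent k ≤ w
  exponent≤w k = proj₁ (blockIndex-bounds _ w _ (keyRank<classSize k))

  offset<2^exponent : ∀ k → offset k < 2 ^ exponent k
  offset<2^exponent k = blockOffset<2^ _ w _ (keyRank<classSize k)

  key-injective : ∀ {k k′} → class k ≡ class k′ → exponent k ≡ exponent k′ → offset k ≡ offset k′ → k ≡ k′
  key-injective {k} {k′} c≡ e≡ o≡ = toℕ-injective (rank-injective labelℕ c≡ (begin
    keyRank k                                        ≡⟨ blockIndex+blockOffset _ w _ (keyRank<classSize k) ⟨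
    classSize (class k) %2^ exponent k + offset k    ≡⟨ cong₂ _+_ (cong₂ (λ c e → classSize c %2^ e) c≡ e≡) o≡ ⟩
    classSize (class k′) %2^ exponent k′ + offset k′ ≡⟨ blockIndex+blockOffset _ w _ (keyRank<classSize k′) ⟩
    keyRank k′                                       ∎))
    where open ≡-Reasoning

  P : ℕ
  P = (l + 1) * suc w

  type : Fin S → ℕ
  type k = class k * suc w + exponent k

  typeSize : ℕ → ℕ
  typeSize t = bit (t % suc w) (classSize (t / suc w)) * 2 ^ (t % suc w)

  type<P : ∀ k → type k < P
  type<P k = begin-strict
    class k * suc w + exponent k ≤⟨ +-monoʳ-≤ (class k * suc w) (exponent≤w k) ⟩
    class k * suc w + w          <⟨ +-monoʳ-< (class k * suc w) ≤-refl ⟩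
    class k * suc w + suc w      ≡⟨ +-comm (class k * suc w) (suc w) ⟩
    suc (class k) * suc w        ≤⟨ *-monoˡ-≤ (suc w) (labelℕ<1+l (toℕ k)) ⟩
    P                            ∎
    where open ≤-Reasoning

  type-class : ∀ k → type k / suc w ≡ class k
  type-class k = [kn+m]/n≡k (class k) (s≤s (exponent≤w k))

  type-exponent : ∀ k → type k % suc w ≡ exponent k
  type-exponent k = [kn+m]%n≡m (class k) (s≤s (exponent≤w k))

  typeSize-type : ∀ k → typeSize (type k) ≡ 2 ^ exponent k
  typeSize-type k = begin
    typeSize (type k)                                       ≡⟨ cong₂ (λ e c → bit e (classSize c) * 2 ^ e) (type-exponent k) (type-class k) ⟩
    bit (exponent k) (classSize (class k)) * 2 ^ exponent k ≡⟨ cong (_* 2 ^ exponent k) (bit-blockIndex _ w _ (keyRank<classSize k)) ⟩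
    1 * 2 ^ exponent k                                      ≡⟨ *-identityˡ (2 ^ exponent k) ⟩
    2 ^ exponent k                                          ∎
    where open ≡-Reasoning

  sumBelow-typeSize : sumBelow P typeSize ≡ S
  sumBelow-typeSize = begin
    sumBelow P typeSize                                                        ≡⟨ sumBelow-* (l + 1) (suc w) typeSize ⟩
    sumBelow (l + 1) (λ s → sumBelow (suc w) (λ e → typeSize (s * suc w + e))) ≡⟨ sumBelow-cong (l + 1) (λ s _ → classTypes s) ⟩
    sumBelow (l + 1) classSize                                                 ≡⟨ sumBelow-count labelℕ (l + 1) S labelℕ<1+l ⟩
    S                                                                          ∎
    where
    open ≡-Reasoning
    instance _ = 2^-nonZero (suc w)
    classTypes : ∀ s → sumBelow (suc w) (λ e → typeSize (s * suc w + e)) ≡ classSize s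
    classTypes s = begin
      sumBelow (suc w) (λ e → typeSize (s * suc w + e))    ≡⟨ sumBelow-cong (suc w) (λ e e≤w →
                                                                cong₂ (λ e′ c → bit e′ (classSize c) * 2 ^ e′)
                                                                      ([kn+m]%n≡m s e≤w) ([kn+m]/n≡k s e≤w)) ⟩
      sumBelow (suc w) (λ e → bit e (classSize s) * 2 ^ e) ≡⟨ sumBelow-bits (suc w) (classSize s) ⟩
      classSize s %2^ suc w                                ≡⟨ m<n⇒m%n≡m (classSize<2^1+w s) ⟩
      classSize s                                          ∎

  open Tuples P

  types : ∀ {n} → Vec (Fin S) n → Vec ℕ n
  types = map type

  types<P : ∀ {n} (v : Vec (Fin S) n) → All (_< P) (types v)
  types<P []      = []
  types<P (k ∷ v) = type<P k ∷ types<P v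

  width : ∀ {n} → Vec (Fin S) n → ℕ
  width []      = 0
  width (k ∷ v) = exponent k + width v

  concatOffsets : ∀ {n} → Vec (Fin S) n → ℕ
  concatOffsets []      = 0
  concatOffsets (k ∷ v) = offset k + concatOffsets v * 2 ^ exponent k

  position : ∀ {n} → Vec (Fin S) n → Fin n → ℕ
  position (k ∷ v) Fin.zero    = 0
  position (k ∷ v) (Fin.suc i) = exponent k + position v i

  product-typeSize : ∀ {n} (v : Vec (Fin S) n) → product typeSize (types v) ≡ 2 ^ width v
  product-typeSize []      = refl
  product-typeSize (k ∷ v) = trans (cong₂ _*_ (typeSize-type k) (product-typeSize v))
                                   (sym (^-distribˡ-+-* 2 (exponent k) (width v)))

  concatOffsets<2^width : ∀ {n} (v : Vec (Fin S) n) → concatOffsets v < 2 ^ width v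
  concatOffsets<2^width []      = s≤s z≤n
  concatOffsets<2^width (k ∷ v) = begin-strict
    offset k + concatOffsets v * 2 ^ exponent k <⟨ +-monoˡ-< (concatOffsets v * 2 ^ exponent k) (offset<2^exponent k) ⟩
    suc (concatOffsets v) * 2 ^ exponent k      ≤⟨ *-monoˡ-≤ (2 ^ exponent k) (concatOffsets<2^width v) ⟩
    2 ^ width v * 2 ^ exponent k                ≡⟨ *-comm (2 ^ width v) (2 ^ exponent k) ⟩
    2 ^ exponent k * 2 ^ width v                ≡⟨ ^-distribˡ-+-* 2 (exponent k) (width v) ⟨
    2 ^ (exponent k + width v)                  ∎
    where open ≤-Reasoning

  bitField-concatOffsets : ∀ {n} (v : Vec (Fin S) n) i →
    bitField (position v i) (exponent (lookup v i)) (concatOffsets v) ≡ offset (lookup v i)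
  bitField-concatOffsets (k ∷ v) Fin.zero = begin
    concatOffsets (k ∷ v) /2^ 0 %2^ exponent k                   ≡⟨ cong (_%2^ exponent k) (n/1≡n (concatOffsets (k ∷ v))) ⟩
    (offset k + concatOffsets v * 2 ^ exponent k) %2^ exponent k ≡⟨ [m+kn]%n≡m%n (offset k) (concatOffsets v) (2 ^ exponent k) ⟩
    offset k %2^ exponent k                                      ≡⟨ m<n⇒m%n≡m (offset<2^exponent k) ⟩
    offset k                                                     ∎
    where
    open ≡-Reasoning
    instance _ = 2^-nonZero (exponent k)
  bitField-concatOffsets (k ∷ v) (Fin.suc i) = begin
    concatOffsets (k ∷ v) /2^ (exponent k + position v i) %2^ e ≡⟨ cong (_%2^ e) (/2^-/2^ (concatOffsets (k ∷ v)) (exponent k) (position v i)) ⟨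
    concatOffsets (k ∷ v) /2^ exponent k /2^ position v i %2^ e ≡⟨ cong (λ y → y /2^ position v i %2^ e) shift ⟩
    concatOffsets v /2^ position v i %2^ e                      ≡⟨ bitField-concatOffsets v i ⟩
    offset (lookup v i)                                         ∎
    where
    open ≡-Reasoning
    instance _ = 2^-nonZero (exponent k)
    e : ℕ
    e = exponent (lookup v i)
    shift : concatOffsets (k ∷ v) /2^ exponent k ≡ concatOffsets v
    shift = trans ([m+kn]/n≡m/n+k (offset k) (concatOffsets v) (2 ^ exponent k))
                  (cong (_+ concatOffsets v) (m<n⇒m/n≡0 (offset<2^exponent k)))

  q : ℕ
  q = b * w

  high : Vec (Fin S) B → ℕ
  high v = concatOffsets v /2^ q

  capacity : Vec ℕ B → ℕ
  capacity g = ⌈ product typeSize g /2^ q ⌉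

  high<capacity : ∀ v → high v < capacity (types v)
  high<capacity v = subst (λ x → high v < ⌈ x /2^ q ⌉) (sym (product-typeSize v))
                      (/2^<⌈/2^⌉ q (concatOffsets<2^width v))

  slot : Vec (Fin S) B → ℕ
  slot v = blockStart B capacity (types v) + high v

  slotCount : ℕ
  slotCount = sumTuples B capacity

  slot<slotCount : ∀ v → slot v < slotCount
  slot<slotCount v = blockStart+<sumTuples B capacity (types<P v) (high<capacity v)

  image : Vec (Fin S) B → ℕ
  image v = concatOffsets v %2^ q + slot v %2^ w * 2 ^ q

  concatOffsets%2^q<2^q : ∀ (v : Vec (Fin S) B) → concatOffsets v %2^ q < 2 ^ q
  concatOffsets%2^q<2^q v = m%n<n (concatOffsets v) (2 ^ q)
    where instance _ = 2^-nonZero q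

  concatOffsets-split : ∀ (v : Vec (Fin S) B) → concatOffsets v ≡ concatOffsets v %2^ q + high v * 2 ^ q
  concatOffsets-split v = m≡m%n+[m/n]*n (concatOffsets v) (2 ^ q)
    where instance _ = 2^-nonZero q

  bit-concatOffsets-low : ∀ v {j} → j < q → bit j (concatOffsets v) ≡ bit j (image v)
  bit-concatOffsets-low v {j} j<q = begin
    bit j (concatOffsets v)                        ≡⟨ cong (bit j) (concatOffsets-split v) ⟩
    bit j (concatOffsets v %2^ q + high v * 2 ^ q) ≡⟨ bit-low _ (high v) j<q ⟩
    bit j (concatOffsets v %2^ q)                  ≡⟨ bit-low _ (slot v %2^ w) j<q ⟨
    bit j (image v)                                ∎
    where open ≡-Reasoning

  bit-concatOffsets-high : ∀ v d → bit (q + d) (concatOffsets v) ≡ bit d (high v)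
  bit-concatOffsets-high v d = trans (cong (bit (q + d)) (concatOffsets-split v))
                                     (bit-high q d (high v) (concatOffsets%2^q<2^q v))

  bit-image-high : ∀ v d → bit (q + d) (image v) ≡ bit d (slot v %2^ w)
  bit-image-high v d = bit-high q d (slot v %2^ w) (concatOffsets%2^q<2^q v)

  types-≡⇒class-≡ : ∀ {n} {v v′ : Vec (Fin S) n} → types v ≡ types v′ → ∀ i →
                     class (lookup v i) ≡ class (lookup v′ i) × exponent (lookup v i) ≡ exponent (lookup v′ i)
  types-≡⇒class-≡ {v = v} {v′} same i =
    trans (sym (type-class (lookup v i))) (trans (cong (_/ suc w) type≡) (type-class (lookup v′ i))) ,
    trans (sym (type-exponent (lookup v i))) (trans (cong (_% suc w) type≡) (type-exponent (lookup v′ i)))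
    where
    type≡ : type (lookup v i) ≡ type (lookup v′ i)
    type≡ = trans (sym (lookup-map i type v)) (trans (cong (λ g → lookup g i) same) (lookup-map i type v′))

  exponents-≡⇒position-≡ : ∀ {n} (v v′ : Vec (Fin S) n) → (∀ i → exponent (lookup v i) ≡ exponent (lookup v′ i)) →
                            ∀ i → position v i ≡ position v′ i
  exponents-≡⇒position-≡ (k ∷ v) (k′ ∷ v′) e≡ Fin.zero    = refl
  exponents-≡⇒position-≡ (k ∷ v) (k′ ∷ v′) e≡ (Fin.suc i) =
    cong₂ _+_ (e≡ Fin.zero) (exponents-≡⇒position-≡ v v′ (λ j → e≡ (Fin.suc j)) i)

  module Encoding (K : ℕ) (slotCount≤ : slotCount ≤ K * 2 ^ w) where

    m : ℕ
    m = suc b * w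

    spill<K : ∀ v → slot v /2^ w < K
    spill<K v = m<n*o⇒m/o<n (<-≤-trans (slot<slotCount v) slotCount≤)
      where instance _ = 2^-nonZero w

    encode : Vec (Fin S) B → Fin K × Vec Bool m
    encode v = fromℕ< (spill<K v) , toBits m (image v)

    open DecodingBySearch {w = w} (Vec-searchable Fin-searchable B) encode

    q+j<m : ∀ {j} → j < w → q + j < m
    q+j<m {j} j<w = subst (q + j <_) (+-comm q w) (+-monoʳ-< q j<w)

    slot-determined : ∀ {v v′} → Agree q v v′ → slot v ≡ slot v′
    slot-determined {v} {v′} (spill≡ , word≡) = begin
      slot v                                ≡⟨ m≡m%n+[m/n]*n (slot v) (2 ^ w) ⟩
      slot v %2^ w + slot v /2^ w * 2 ^ w   ≡⟨ cong₂ (λ x y → x + y * 2 ^ w) low≡ high≡ ⟩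
      slot v′ %2^ w + slot v′ /2^ w * 2 ^ w ≡⟨ m≡m%n+[m/n]*n (slot v′) (2 ^ w) ⟨
      slot v′                               ∎
      where
      open ≡-Reasoning
      instance _ = 2^-nonZero w
      high≡ : slot v /2^ w ≡ slot v′ /2^ w
      high≡ = trans (sym (toℕ-fromℕ< (spill<K v))) (trans (cong toℕ spill≡) (toℕ-fromℕ< (spill<K v′)))
      low≡ : slot v %2^ w ≡ slot v′ %2^ w
      low≡ = trans (sym (m%n%n≡m%n (slot v) (2 ^ w))) (trans (bits-agree⇒%2^≡ w λ j j<w →
               trans (sym (bit-image-high v j))
                 (trans (readWord-toBits-≡⇒bit-≡ w m {image v} {image v′} q word≡ j j<w (q+j<m j<w)) (bit-image-high v′ j)))
             (m%n%n≡m%n (slot v′) (2 ^ w)))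

    types-high-determined : ∀ {v v′} → Agree q v v′ → types v ≡ types v′ × high v ≡ high v′
    types-high-determined {v} {v′} agree = blockStart-injective B capacity (types<P v) (types<P v′)
                                             (high<capacity v) (high<capacity v′) (slot-determined {v} {v′} agree)

    bit-concatOffsets-determined : ∀ {v v′} → Agree q v v′ → ∀ p → Agree p v v′ →
                                   ∀ j → j < w → bit (p + j) (concatOffsets v) ≡ bit (p + j) (concatOffsets v′)
    bit-concatOffsets-determined {v} {v′} agree p (_ , word≡) j j<w with p + j <? q
    ... | yes p+j<q = begin
      bit (p + j) (concatOffsets v)  ≡⟨ bit-concatOffsets-low v p+j<q ⟩
      bit (p + j) (image v)          ≡⟨ readWord-toBits-≡⇒bit-≡ w m p word≡ j j<w (<-≤-trans p+j<q (m≤n+m q w)) ⟩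
      bit (p + j) (image v′)         ≡⟨ bit-concatOffsets-low v′ p+j<q ⟨
      bit (p + j) (concatOffsets v′) ∎
      where open ≡-Reasoning
    ... | no p+j≮q = subst (λ i → bit i (concatOffsets v) ≡ bit i (concatOffsets v′)) (m+[n∸m]≡n (≮⇒≥ p+j≮q)) (begin
      bit (q + d) (concatOffsets v)  ≡⟨ bit-concatOffsets-high v d ⟩
      bit d (high v)                 ≡⟨ cong (bit d) (proj₂ (types-high-determined {v} {v′} agree)) ⟩
      bit d (high v′)                ≡⟨ bit-concatOffsets-high v′ d ⟨
      bit (q + d) (concatOffsets v′) ∎)
      where
      open ≡-Reasoning
      d : ℕ
      d = p + j ∸ q

    position-determined : ∀ i {v v′} → Agree q v v′ → position v i ≡ position v′ i
    position-determined i {v} {v′} agree = exponents-≡⇒position-≡ v v′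
      (λ j → proj₂ (types-≡⇒class-≡ (proj₁ (types-high-determined {v} {v′} agree)) j)) i

    key-determined : ∀ i {v v′} → Agree q v v′ → Agree (position v i) v v′ → lookup v i ≡ lookup v′ i
    key-determined i {v} {v′} agree agreeᵢ = key-injective class≡ exponent≡ (begin
      offset (lookup v i)                                                  ≡⟨ bitField-concatOffsets v i ⟨
      bitField p e (concatOffsets v)                                       ≡⟨ bits-agree⇒bitField≡ p e (λ j j<e →
                                                                                bit-concatOffsets-determined {v} {v′} agree p agreeᵢ j
                                                                                  (<-≤-trans j<e (exponent≤w (lookup v i)))) ⟩
      bitField p e (concatOffsets v′)                                      ≡⟨ cong₂ (λ p′ e′ → bitField p′ e′ (concatOffsets v′)) position≡ exponent≡ ⟩
      bitField (position v′ i) (exponent (lookup v′ i)) (concatOffsets v′) ≡⟨ bitField-concatOffsets v′ i ⟩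
      offset (lookup v′ i)                                                 ∎)
      where
      open ≡-Reasoning
      p e : ℕ
      p = position v i
      e = exponent (lookup v i)
      types≡ : types v ≡ types v′
      types≡ = proj₁ (types-high-determined {v} {v′} agree)
      class≡ : class (lookup v i) ≡ class (lookup v′ i)
      class≡ = proj₁ (types-≡⇒class-≡ types≡ i)
      exponent≡ : exponent (lookup v i) ≡ exponent (lookup v′ i)
      exponent≡ = proj₂ (types-≡⇒class-≡ types≡ i)
      position≡ : position v i ≡ position v′ i
      position≡ = position-determined i {v} {v′} agree

    prefixSum-determined : ∀ i {v v′} → Agree q v v′ →
      prefixSum (λ j → label (lookup v j)) i ≡ prefixSum (λ j → label (lookup v′ j)) i
    prefixSum-determined i {v} {v′} agree = prefixSum-cong (λ j →
      trans (sym (labelℕ-toℕ (lookup v j)))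
        (trans (proj₁ (types-≡⇒class-≡ (proj₁ (types-high-determined {v} {v′} agree)) j)) (labelℕ-toℕ (lookup v′ j)))) i

    keyDecoder : ∀ i → TwoProbeDecoder (λ v → lookup v i)
    keyDecoder i = decodeBySearch (fromℕ< 0<S) q (λ v → position v i) (λ v → lookup v i)
                     (λ {v} {v′} → position-determined i {v} {v′}) (λ {v} {v′} → key-determined i {v} {v′})
      where
      0<S : 0 < S
      0<S = ≤-trans (m^n>0 2 w) (m≤m+n (2 ^ w) σ)

    prefixSumDecoder : ∀ i → TwoProbeDecoder (λ v → prefixSum (λ j → label (lookup v j)) i)
    prefixSumDecoder i = decodeBySearch 0 q (λ _ → q) (λ v → prefixSum (λ j → label (lookup v j)) i)
                           (λ _ → refl) (λ {v} {v′} agree _ → prefixSum-determined i {v} {v′} agree)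

    tupleDS : TupleDS w S B K m 2 label
    tupleDS = record
      { encode       = λ ks → encode (tabulate ks)
      ; decK         = λ i → proj₁ (keyDecoder i)
      ; decT         = λ i → proj₁ (prefixSumDecoder i)
      ; decK-correct = λ ks i → trans (proj₁ (proj₂ (keyDecoder i) (tabulate ks))) (lookup∘tabulate ks i)
      ; decT-correct = λ ks i → trans (proj₁ (proj₂ (prefixSumDecoder i) (tabulate ks)))
                                      (prefixSum-cong (λ j → cong label (lookup∘tabulate ks j)) i)
      ; decK-time    = λ ks i → ≤-reflexive (proj₂ (proj₂ (keyDecoder i) (tabulate ks)))
      ; decT-time    = λ ks i → ≤-reflexive (proj₂ (proj₂ (prefixSumDecoder i) (tabulate ks)))
      }

  2^q*slotCount≤ : 2 ^ q * slotCount ≤ S ^ B + P ^ B * 2 ^ q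
  2^q*slotCount≤ = begin
    2 ^ q * slotCount                                          ≡⟨ sumTuples-distribˡ-* B (2 ^ q) capacity ⟨
    sumTuples B (λ g → 2 ^ q * capacity g)                     ≤⟨ sumTuples-mono B (λ g →
                                                                  ≤-trans (≤-reflexive (*-comm (2 ^ q) (capacity g)))
                                                                          (⌈/2^⌉*2^≤ q (product typeSize g))) ⟩
    sumTuples B (λ g → product typeSize g + 2 ^ q)             ≡⟨ sumTuples-distrib-+ B (product typeSize) (λ _ → 2 ^ q) ⟩
    sumTuples B (product typeSize) + sumTuples B (λ _ → 2 ^ q) ≡⟨ cong₂ _+_ (trans (sumTuples-product B typeSize)
                                                                                    (cong (_^ B) sumBelow-typeSize))
                                                                         (sumTuples-const B (2 ^ q)) ⟩
    S ^ B + P ^ B * 2 ^ q                                      ∎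
    where open ≤-Reasoning

  slotCount≤ : 3 * B * σ ≤ 2 ^ w → P ^ B ≤ σ * 2 ^ w → slotCount ≤ (2 ^ w + 2 * B * σ) * 2 ^ w
  slotCount≤ 3Bσ≤M P^B≤σM = *-cancelˡ-≤ (2 * M * Q) (begin
    2 * M * Q * slotCount                                   ≡⟨ *-assoc (2 * M) Q slotCount ⟩
    2 * M * (Q * slotCount)                                 ≤⟨ *-monoʳ-≤ (2 * M) 2^q*slotCount≤ ⟩
    2 * M * (S ^ B + P ^ B * Q)                             ≡⟨ *-distribˡ-+ (2 * M) (S ^ B) (P ^ B * Q) ⟩
    2 * M * S ^ B + 2 * M * (P ^ B * Q)                     ≤⟨ +-mono-≤ (binomial-bound M σ B 3Bσ≤M)
                                                                         (*-monoʳ-≤ (2 * M) (*-monoˡ-≤ Q P^B≤σM)) ⟩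
    2 * M ^ suc B + 3 * B * σ * M ^ B + 2 * M * (σ * M * Q) ≡⟨ cong (λ Z → 2 * (M * (M * (M * Z))) + 3 * B * σ * (M * (M * Z))
                                                                            + 2 * M * (σ * M * Q)) M^b≡Q ⟩
    2 * (M * X) + 3 * B * σ * X + 2 * M * (σ * M * Q)       ≡⟨ cong (2 * (M * X) + 3 * B * σ * X +_) (regroup M σ Q) ⟩
    2 * (M * X) + 3 * B * σ * X + 2 * σ * X                 ≤⟨ +-monoʳ-≤ (2 * (M * X) + 3 * B * σ * X)
                                                                 (*-monoˡ-≤ X (*-monoˡ-≤ σ (s≤s (s≤s (z≤n {b}))))) ⟩
    2 * (M * X) + 3 * B * σ * X + B * σ * X                 ≡⟨ factor M Q B σ ⟩
    2 * M * Q * ((M + 2 * B * σ) * M)                       ∎)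
    where
    open ≤-Reasoning
    M Q X : ℕ
    M = 2 ^ w
    Q = 2 ^ q
    X = M * (M * Q)
    M^b≡Q : M ^ b ≡ Q
    M^b≡Q = trans (^-*-assoc 2 w b) (cong (2 ^_) (*-comm w b))
    regroup : ∀ M σ Q → 2 * M * (σ * M * Q) ≡ 2 * σ * (M * (M * Q))
    regroup = solve-∀
    factor : ∀ M Q B σ → 2 * (M * (M * (M * Q))) + 3 * B * σ * (M * (M * Q)) + B * σ * (M * (M * Q)) ≡
                         2 * M * Q * ((M + 2 * B * σ) * M)
    factor = solve-∀
    instance _ = m*n≢0 (2 * M) Q {{m*n≢0 2 M {{_}} {{2^-nonZero w}}}} {{2^-nonZero q}}

tupleStructure : ∀ {w σ l} B (SUM : Fin (2 ^ w + σ) → Fin (l + 1)) → 2 ≤ B →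
  σ < 2 ^ w → 3 * B * σ ≤ 2 ^ w → ((l + 1) * suc w) ^ B ≤ σ * 2 ^ w →
  TupleDS w (2 ^ w + σ) B (2 ^ w + 2 * B * σ) ((B ∸ 1) * w) 2 (λ k → toℕ (SUM k))
tupleStructure (suc zero) _ (s≤s ())
tupleStructure {w} {σ} {l} (suc (suc b)) SUM _ σ<2^w 3Bσ≤2^w P^B≤σ2^w =
  Encoding.tupleDS (2 ^ w + 2 * suc (suc b) * σ) (slotCount≤ 3Bσ≤2^w P^B≤σ2^w)
  where open TupleCode w σ l b SUM σ<2^w

-- Choice of parameters

n<2^n : ∀ n → n < 2 ^ n
n<2^n zero    = s≤s z≤n
n<2^n (suc n) = begin-strict
  suc n     ≤⟨ n<2^n n ⟩
  2 ^ n     <⟨ ^-monoʳ-< 2 ≤-refl (n<1+n n) ⟩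
  2 ^ suc n ∎
  where open ≤-Reasoning

[m*n]^o≡m^o*n^o : ∀ m n o → (m * n) ^ o ≡ m ^ o * n ^ o
[m*n]^o≡m^o*n^o m n zero    = refl
[m*n]^o≡m^o*n^o m n (suc o) = trans (cong (m * n *_) ([m*n]^o≡m^o*n^o m n o)) (*-interchange m n (m ^ o) (n ^ o))

[1+n³]^n≤2^n³ : ∀ n → 3 ≤ n → suc (n ^ 3) ^ n ≤ 2 ^ (n ^ 3)
[1+n³]^n≤2^n³ n 3≤n = begin
  suc (n ^ 3) ^ n   ≤⟨ ^-monoˡ-≤ n (^-monoˡ-< 3 (n<1+n n)) ⟩
  (suc n ^ 3) ^ n   ≤⟨ ^-monoˡ-≤ n (^-monoˡ-≤ 3 (n<2^n n)) ⟩
  ((2 ^ n) ^ 3) ^ n ≡⟨ trans (cong (_^ n) (^-*-assoc 2 n 3)) (^-*-assoc 2 (n * 3) n) ⟩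
  2 ^ (n * 3 * n)   ≤⟨ ^-monoʳ-≤ 2 3n²≤n³ ⟩
  2 ^ (n ^ 3)       ∎
  where
  open ≤-Reasoning
  3n²≤n³ : n * 3 * n ≤ n ^ 3
  3n²≤n³ = begin
    n * 3 * n   ≡⟨ *-assoc n 3 n ⟩
    n * (3 * n) ≤⟨ *-monoʳ-≤ n (*-monoˡ-≤ n 3≤n) ⟩
    n * (n * n) ≡⟨ cong (λ x → n * (n * x)) (*-identityʳ n) ⟨
    n ^ 3       ∎

4≤cubeRoot : ∀ {n B} → 16 ≤ n → n ^ 7 ≤ 2 ^ (B ^ 3) → 4 ≤ B
4≤cubeRoot {n} {B} 16≤n n⁷≤2^B³ with 4 ≤? B
... | yes 4≤B = 4≤B
... | no 4≰B  = ⊥-elim (<⇒≱ 2^27<16^7 (begin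
  16 ^ 7      ≤⟨ ^-monoˡ-≤ 7 16≤n ⟩
  n ^ 7       ≤⟨ n⁷≤2^B³ ⟩
  2 ^ (B ^ 3) ≤⟨ ^-monoʳ-≤ 2 (^-monoˡ-≤ 3 (≤-pred (≰⇒> 4≰B))) ⟩
  2 ^ 27      ∎))
  where
  open ≤-Reasoning
  2^27<16^7 : 2 ^ 27 < 16 ^ 7
  2^27<16^7 = toWitness {a? = 2 ^ 27 <? 16 ^ 7} tt

3Bσ≤2^w : ∀ {n w B j l σ} → 4 ≤ B → w ≡ B ^ 3 → l ≡ B ^ j * w → B * l ≤ n → σ * n ≤ 2 ^ w → 3 * B * σ ≤ 2 ^ w
3Bσ≤2^w {n} {w} {B} {j} {l} {σ} 4≤B refl refl Bl≤n σn≤2^w = begin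
  3 * B * σ ≤⟨ *-monoˡ-≤ σ 3B≤n ⟩
  n * σ     ≡⟨ *-comm n σ ⟩
  σ * n     ≤⟨ σn≤2^w ⟩
  2 ^ w     ∎
  where
  open ≤-Reasoning
  instance
    B≢0 : NonZero B
    B≢0 = >-nonZero (≤-trans (s≤s z≤n) 4≤B)
    _ = m^n≢0 B j
    _ = m^n≢0 B 2
  3B≤n : 3 * B ≤ n
  3B≤n = begin
    3 * B     ≡⟨ *-comm 3 B ⟩
    B * 3     ≤⟨ *-monoʳ-≤ B (≤-trans (≤-trans (n≤1+n 3) 4≤B) (m≤m*n B (B * (B * 1)))) ⟩
    B * B ^ 3 ≤⟨ *-monoʳ-≤ B (m≤n*m (B ^ 3) (B ^ j)) ⟩
    B * l     ≤⟨ Bl≤n ⟩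
    n         ∎

m*n≤o⇒m<o : ∀ {m n o} → 0 < m → 2 ≤ n → m * n ≤ o → m < o
m*n≤o⇒m<o {m} {n} 0<m 2≤n mn≤o = <-≤-trans (m<m*n m n {{>-nonZero 0<m}} 2≤n) mn≤o

[[l+1][1+w]]^B≤σ2^w : ∀ {w B l σ} → 3 ≤ B → w ≡ B ^ 3 → (l + 1) ^ B ≤ 2 ^ (w / 2) → 2 ^ (w / 2) ≤ σ →
                      ((l + 1) * suc w) ^ B ≤ σ * 2 ^ w
[[l+1][1+w]]^B≤σ2^w {w} {B} {l} {σ} 3≤B refl [l+1]^B≤ 2^[w/2]≤σ = begin
  ((l + 1) * suc w) ^ B   ≡⟨ [m*n]^o≡m^o*n^o (l + 1) (suc w) B ⟩
  (l + 1) ^ B * suc w ^ B ≤⟨ *-mono-≤ (≤-trans [l+1]^B≤ 2^[w/2]≤σ) ([1+n³]^n≤2^n³ B 3≤B) ⟩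
  σ * 2 ^ w               ∎
  where open ≤-Reasoning

lemma4 : Σ ℕ λ c → Σ ℕ λ N → (n : ℕ) → N ≤ n →
    (w B j l σ : ℕ) →
    n ^ 7 ≤ 2 ^ w → w % 2 ≡ 0 → w ≡ B ^ 3 →
    l ≡ B ^ j * w → B * l ≤ n →
    (l + 1) ^ B ≤ 2 ^ (w / 2) →
    n * 2 ^ (w / 2) ≤ σ → σ * n ≤ 2 ^ w →
    (SUM : Fin (2 ^ w + σ) → Fin (l + 1)) →
    (Σ (Vec Bool l → Fin (2 ^ w + σ) × Vec Bool (l ∸ w)) λ enc →
       Injective _≡_ _≡_ enc × ((a : Vec Bool l) → toℕ (SUM (proj₁ (enc a))) ≡ ones a)) →
    Σ ℕ λ K → K ≤ 2 ^ w + 2 * B * σ ×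
      TupleDS w (2 ^ w + σ) B K ((B ∸ 1) * w) c (λ k → toℕ (SUM k))
lemma4 = 2 , 16 , λ n 16≤n w B j l σ n⁷≤2^w _ w≡B³ l≡B^jw Bl≤n [l+1]^B≤ n2^[w/2]≤σ σn≤2^w SUM _ →
  let 4≤B : 4 ≤ B
      4≤B = 4≤cubeRoot 16≤n (subst (λ x → n ^ 7 ≤ 2 ^ x) w≡B³ n⁷≤2^w)
      2≤n : 2 ≤ n
      2≤n = ≤-trans (s≤s (s≤s z≤n)) 16≤n
      2^[w/2]≤σ : 2 ^ (w / 2) ≤ σ
      2^[w/2]≤σ = ≤-trans (m≤n*m (2 ^ (w / 2)) n {{>-nonZero (≤-trans (s≤s z≤n) 2≤n)}}) n2^[w/2]≤σ
  in 2 ^ w + 2 * B * σ , ≤-refl ,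
     tupleStructure B SUM (≤-trans (s≤s (s≤s z≤n)) 4≤B)
       (m*n≤o⇒m<o (≤-trans (m^n>0 2 (w / 2)) 2^[w/2]≤σ) 2≤n σn≤2^w)
       (3Bσ≤2^w {j = j} 4≤B w≡B³ l≡B^jw Bl≤n σn≤2^w)
       ([[l+1][1+w]]^B≤σ2^w (≤-trans (n≤1+n 3) 4≤B) w≡B³ [l+1]^B≤ 2^[w/2]≤σ)
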